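{- Let $\mathcal{H}$ be the square of an $n$-vertex cycle and let $F \subseteq E(\mathcal{H})$ with $|F| = h$. Then for all integers $\ell, c \ge 0$, the number of subsets $J \subseteq F$ with $|J| = \ell$ such that the graph formed by the edges of $J$ has exactly $c$ connected components is at most \[ (8e)^{\ell} \binom{2h}{c}. \]
   Context: The square of a cycle $C$ is the graph on $V(C)$ in which two vertices are adjacent iff their distance in $C$ is at most $2$. For a set of edges $J$, the graph formed by $J$ has as vertices exactly those vertices incident to some edge of $J$; its components are counted in that graph. -}

module Defs where

open import Data.Nat using (ℕ; suc; _+_; _*_; _∸_; _^_; _≤_; _<_)
open import Data.Nat.Combinatorics using (_C_)
open import Data.Fin using (Fin; toℕ)
open import Data.Fin.Subset using (Subset; _∈_; ∣_∣)
open import Data.Vec using (Vec; lookup)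
open import Data.List using (List; length)
open import Data.List.Relation.Unary.All using (All)
open import Data.List.Relation.Unary.Unique.Propositional using (Unique)
open import Data.Product using (Σ; ∃; _×_; _,_)
open import Data.Sum using (_⊎_)
open import Relation.Binary.PropositionalEquality using (_≡_)
open import Relation.Binary.Construct.Closure.ReflexiveTransitive using (Star)
open import Function.Bundles using (_⇔_)

-- Vertices of the n-cycle are Fin n, with i adjacent to i±1 (mod n).
-- An edge of the square H of C_n is stored as an ordered pair (i , j) with
-- toℕ i < toℕ j (canonical representative of the unordered pair {i,j})
-- and cyclic distance ≤ 2, i.e. min(d, n - d) ≤ 2 where d = j - i.
IsSqEdge : (n : ℕ) → Fin n × Fin n → Set
IsSqEdge n (i , j) =
  (toℕ i < toℕ j) × ((toℕ j ∸ toℕ i ≤ 2) ⊎ (n ≤ (toℕ j ∸ toℕ i) + 2))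

-- F is given as an injective enumeration (a duplicate-free list) of h edges.
-- A subset J ⊆ F is a Subset h of the indices of F.

EdgeIn : ∀ {n h} → Vec (Fin n × Fin n) h → Subset h → Fin n → Fin n → Set
EdgeIn F J u v = ∃ λ k → (k ∈ J) × (lookup F k ≡ (u , v))

AdjJ : ∀ {n h} → Vec (Fin n × Fin n) h → Subset h → Fin n → Fin n → Set
AdjJ F J u v = EdgeIn F J u v ⊎ EdgeIn F J v u

Incident : ∀ {n h} → Vec (Fin n × Fin n) h → Subset h → Fin n → Set
Incident F J v = ∃ λ u → AdjJ F J v u

Connected : ∀ {n h} → Vec (Fin n × Fin n) h → Subset h → Fin n → Fin n → Set
Connected F J = Star (AdjJ F J)

-- The graph formed by J has exactly c connected components: there is a
-- labelling of its vertices by Fin c whose fibres (on the vertex set) are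
-- exactly the connected components, and every label is used.
HasComponents : ∀ {n h} → Vec (Fin n × Fin n) h → Subset h → ℕ → Set
HasComponents {n} F J c =
  Σ (Fin n → Fin c) λ f →
    (∀ u v → Incident F J u → Incident F J v → (f u ≡ f v) ⇔ Connected F J u v)
    × (∀ k → ∃ λ v → Incident F J v × (f v ≡ k))

-- "The number of subsets J ⊆ F with |J| = ℓ and c components is at most B"
-- is expressed as: every duplicate-free list of such subsets has length ≤ B.
-- The real bound B = (8e)^ℓ · C(2h,c) is expressed through the decreasing
-- sequence (1 + 1/N)^(N+1) ↓ e: X ≤ 8^ℓ e^ℓ C  iff for all N ≥ 1,
-- X · N^(ℓ(N+1)) ≤ 8^ℓ · C · (N+1)^(ℓ(N+1)).
BoundedBy8eC : (X ℓ h c : ℕ) → Set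
BoundedBy8eC X ℓ h c =
  ∀ N → 1 ≤ N →
    X * N ^ (ℓ * suc N) ≤ 8 ^ ℓ * ((2 * h) C c) * (suc N) ^ (ℓ * suc N)

GoodSubset : ∀ {n h} → Vec (Fin n × Fin n) h → ℕ → ℕ → Subset h → Set
GoodSubset F ℓ c J = (∣ J ∣ ≡ ℓ) × HasComponents F J c

-- Pick one edge in each component of J; these c edges form a key R ⊆ F, one of
-- C(h, c) subsets. The other ℓ − c edges are recovered by exploring from the endpoints of R:
-- every vertex of the square of a cycle has four neighbours, so each endpoint starts with three
-- undecided (root , neighbour) pairs, and deciding a pair either rejects it or accepts its edge,
-- whose new endpoint brings three undecided pairs of its own. Weighting a state with ℓ edges
-- still to find and D undecided pairs by (27/4)^ℓ (3/2)^D, the two outcomes carry the fractions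
-- 2/3 and 1/3 of the weight, so the weight bounds the number of edge sets a state can produce.
-- Summing over the keys gives C(h, c) (27/4)^(ℓ − c) (3/2)^(6c) ≤ 16^ℓ C(h, c) ≤ (8e)^ℓ C(2h, c).

{-# OPTIONS --safe #-}
module Submission where

open import Defs
open import Data.Empty using (⊥-elim)
open import Data.Fin using (Fin; zero; suc; toℕ)
open import Data.Fin.Properties using (toℕ-injective; toℕ-fromℕ<; toℕ<n; any?; 0≢1+n)
  renaming (_≟_ to _≟ᶠ_; suc-injective to fsuc-injective)
open import Data.Fin.Subset
  using (Subset; _∈_; _∉_; _⊆_; ∣_∣; ⁅_⁆; _∪_; _─_; _-_; inside; outside)
  renaming (⊥ to ∅)
open import Data.Fin.Subset.Properties
  using ( _∈?_; ⊆-refl; ⊆-antisym; p─q⊆p; x∈p∧x∉q⇒x∈p─q; drop-∷-⊆; ∣⁅x⁆∣≡1; x∈⁅x⁆; x∈⁅y⁆⇒x≡y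
        ; x∈p∪q⁺; x∈p∪q⁻; ∪-identityˡ; ∉⊥; ∣⊥∣≡0; Empty-unique; p⊆q⇒∣p∣≤∣q∣; x∈p⇒∣p-x∣<∣p∣ )
open import Data.List using (List; []; _∷_; _++_; map; filter; concatMap; length)
open import Data.List.Properties using (length-map; length-++; filter-notAll)
open import Data.List.Membership.Propositional using (find) renaming (_∈_ to _∈ₗ_)
open import Data.List.Membership.Propositional.Properties
  using (∈-map⁺; ∈-map⁻; ∈-++⁺ˡ; ∈-++⁺ʳ; ∈-++⁻; ∈-filter⁺)
open import Data.List.Relation.Unary.All as All using (All; []; _∷_)
import Data.List.Relation.Unary.All.Properties as All
open import Data.List.Relation.Unary.Any as Any using (here; there)
open import Data.List.Relation.Unary.Any.Properties using (concatMap⁺; concatMap⁻)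
open import Data.List.Relation.Unary.AllPairs using (AllPairs; []; _∷_)
import Data.List.Relation.Unary.AllPairs.Properties as AllPairs
open import Data.List.Relation.Unary.Unique.Propositional using (Unique)
import Data.List.Relation.Unary.Unique.Propositional.Properties as Unique
open import Data.Nat
  using (ℕ; zero; suc; _+_; _*_; _∸_; _^_; _≤_; _<_; _≤′_; ≤′-refl; ≤′-step; z≤n; s≤s; s≤s⁻¹; NonZero; >-nonZero)
open import Data.Nat.Combinatorics using (_C_; nCk+nC[k+1]≡[n+1]C[k+1])
open import Data.Nat.DivMod using (_%_; _mod_; m<n⇒m%n≡m; [m+n]%n≡m%n)
open import Data.Nat.Properties
  using ( ≤-refl; ≤-reflexive; ≤-trans; <⇒≤; <-asym; ≤-<-trans; ≤⇒≤′; n≤1+n; m≤m+n; m≤n+m; m≤n*m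
        ; +-comm; +-assoc; +-suc; +-identityʳ; *-comm; *-distribʳ-+; ^-*-assoc; ^-distribˡ-+-*
        ; +-mono-≤; +-monoʳ-≤; +-monoˡ-≤; *-mono-≤; *-monoʳ-≤; *-monoˡ-≤; ^-monoˡ-≤; *-cancelʳ-≤
        ; m^n≢0; m*n≢0; m<n⇒0<n∸m; m+[n∸m]≡n; m∸[m∸n]≡n; m∸n+n≡m; m+n∸n≡m; m+n∸m≡n; ∸-monoˡ-≤
        ; suc-injective; m∸n≤m; *-suc; m<n⇒n≢0; module ≤-Reasoning )
open import Data.Nat.Tactic.RingSolver using (solve-∀)
open import Data.Product using (∃; ∃₂; _×_; _,_; proj₁; proj₂)
open import Data.Product.Properties using () renaming (≡-dec to ×-≡-dec)
open import Data.Sum using (_⊎_; inj₁; inj₂) renaming (swap to ⊎-swap)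
open import Data.Vec using (Vec; lookup; []; _∷_; here; there)
open import Data.Vec.Properties using () renaming (≡-dec to Vec-≡-dec)
open import Data.Vec.Relation.Unary.All using () renaming (All to VAll)
open import Data.Vec.Relation.Unary.All.Properties using (lookup⁺)
open import Data.Bool.Properties using () renaming (_≟_ to _≟ᵇ_)
open import Function using (_∘_; _on_)
open import Function.Bundles using (Equivalence; _⇔_)
open import Function.Definitions using (Injective)
open import Relation.Binary.Construct.Closure.ReflexiveTransitive using (ε; _◅_)
open import Relation.Binary.PropositionalEquality
  using (_≡_; _≢_; refl; sym; trans; cong; cong₂; subst; subst₂; module ≡-Reasoning)
open import Relation.Nullary using (¬_; Dec; yes; no; ¬?; _⊎-dec_; contradiction)
open import Relation.Unary using (Decidable)
open import Relation.Unary.Properties using (∁?)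
open import Relation.Binary.Definitions using (DecidableEquality)

^-distribʳ-* : ∀ m n k → (m * n) ^ k ≡ m ^ k * n ^ k
^-distribʳ-* m n zero    = refl
^-distribʳ-* m n (suc k) = trans (cong (m * n *_) (^-distribʳ-* m n k)) (interchange m n (m ^ k) (n ^ k))
  where
  interchange : ∀ a b c d → a * b * (c * d) ≡ a * c * (b * d)
  interchange = solve-∀

binomial-lower-bound : ∀ N m → N ^ suc m + suc m * N ^ m ≤ suc N ^ suc m
binomial-lower-bound N zero    = ≤-reflexive (+-comm (N * 1) 1)
binomial-lower-bound N (suc m) = begin
  N ^ suc (suc m) + suc (suc m) * N ^ suc m                 ≤⟨ m≤m+n _ (suc m * N ^ m) ⟩
  N ^ suc (suc m) + suc (suc m) * N ^ suc m + suc m * N ^ m ≡⟨ expand N (suc m) (N ^ m) ⟩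
  suc N * (N ^ suc m + suc m * N ^ m)                       ≤⟨ *-monoʳ-≤ (suc N) (binomial-lower-bound N m) ⟩
  suc N ^ suc (suc m)                                       ∎
  where
  open ≤-Reasoning
  expand : ∀ N k P → N * (N * P) + suc k * (N * P) + k * P ≡ suc N * (N * P + k * P)
  expand = solve-∀

2*N^[1+N]≤[1+N]^[1+N] : ∀ N → 2 * N ^ suc N ≤ suc N ^ suc N
2*N^[1+N]≤[1+N]^[1+N] N = begin
  2 * N ^ suc N             ≡⟨ cong (N ^ suc N +_) (+-identityʳ (N ^ suc N)) ⟩
  N ^ suc N + N * N ^ N     ≤⟨ +-monoʳ-≤ (N ^ suc N) (*-monoˡ-≤ (N ^ N) (n≤1+n N)) ⟩
  N ^ suc N + suc N * N ^ N ≤⟨ binomial-lower-bound N N ⟩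
  suc N ^ suc N             ∎
  where open ≤-Reasoning

-- 16 ≤ 8e, since 2 ≤ (1 + 1/N)^(N + 1); this holds for every N.
16^ℓ-bound⇒BoundedBy8eC : ∀ {L K ℓ h c} → L ≤ 16 ^ ℓ * K → K ≤ (2 * h) C c → BoundedBy8eC L ℓ h c
16^ℓ-bound⇒BoundedBy8eC {L} {K} {ℓ} {h} {c} L≤ K≤ N _ = begin
  L * N ^ (ℓ * suc N)                        ≡⟨ cong (L *_) (power-swap N) ⟩
  L * (N ^ suc N) ^ ℓ                        ≤⟨ *-monoˡ-≤ ((N ^ suc N) ^ ℓ) (≤-trans L≤ (*-monoʳ-≤ (16 ^ ℓ) K≤)) ⟩
  16 ^ ℓ * C₂ * (N ^ suc N) ^ ℓ              ≡⟨ cong (λ x → x * C₂ * (N ^ suc N) ^ ℓ) (^-distribʳ-* 8 2 ℓ) ⟩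
  8 ^ ℓ * 2 ^ ℓ * C₂ * (N ^ suc N) ^ ℓ       ≡⟨ regroup (8 ^ ℓ) (2 ^ ℓ) C₂ ((N ^ suc N) ^ ℓ) ⟩
  8 ^ ℓ * C₂ * (2 ^ ℓ * (N ^ suc N) ^ ℓ)     ≡⟨ cong (8 ^ ℓ * C₂ *_) (sym (^-distribʳ-* 2 (N ^ suc N) ℓ)) ⟩
  8 ^ ℓ * C₂ * (2 * N ^ suc N) ^ ℓ           ≤⟨ *-monoʳ-≤ (8 ^ ℓ * C₂) (^-monoˡ-≤ ℓ (2*N^[1+N]≤[1+N]^[1+N] N)) ⟩
  8 ^ ℓ * C₂ * (suc N ^ suc N) ^ ℓ           ≡⟨ cong (8 ^ ℓ * C₂ *_) (sym (power-swap (suc N))) ⟩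
  8 ^ ℓ * C₂ * suc N ^ (ℓ * suc N)           ∎
  where
  open ≤-Reasoning
  C₂ = (2 * h) C c
  power-swap : ∀ x → x ^ (ℓ * suc N) ≡ (x ^ suc N) ^ ℓ
  power-swap x = trans (cong (x ^_) (*-comm ℓ (suc N))) (sym (^-*-assoc x (suc N) ℓ))
  regroup : ∀ a b c d → a * b * c * d ≡ a * c * (b * d)
  regroup = solve-∀

C-mono-suc : ∀ m k → m C k ≤ suc m C k
C-mono-suc m zero    = ≤-refl
C-mono-suc m (suc k) = subst (m C suc k ≤_) (nCk+nC[k+1]≡[n+1]C[k+1] m k) (m≤n+m _ _)

C-monoˡ : ∀ {m m′} k → m ≤ m′ → m C k ≤ m′ C k
C-monoˡ k = go ∘ ≤⇒≤′
  where
  go : ∀ {m m′} → m ≤′ m′ → m C k ≤ m′ C k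
  go ≤′-refl       = ≤-refl
  go (≤′-step m≤′) = ≤-trans (go m≤′) (C-mono-suc _ k)

-- L ≤ (27/4)^ℓ (3/2)^D, with the denominators cleared.
record CountBound (L ℓ D : ℕ) : Set where
  constructor count-bound
  field cleared : L * (4 ^ ℓ * 2 ^ D) ≤ 27 ^ ℓ * 3 ^ D

open CountBound

countBound-≤1 : ∀ {L} ℓ D → L ≤ 1 → CountBound L ℓ D
countBound-≤1 {L} ℓ D L≤1 = count-bound (begin
  L * (4 ^ ℓ * 2 ^ D)  ≤⟨ *-monoˡ-≤ (4 ^ ℓ * 2 ^ D) L≤1 ⟩
  1 * (4 ^ ℓ * 2 ^ D)  ≡⟨ +-identityʳ (4 ^ ℓ * 2 ^ D) ⟩
  4 ^ ℓ * 2 ^ D        ≤⟨ *-mono-≤ (^-monoˡ-≤ ℓ (m≤m+n 4 23)) (^-monoˡ-≤ D (n≤1+n 2)) ⟩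
  27 ^ ℓ * 3 ^ D       ∎)
  where open ≤-Reasoning

countBound-suc : ∀ {L ℓ D} → CountBound L ℓ D → CountBound L ℓ (suc D)
countBound-suc {L} {ℓ} {D} (count-bound bound) = count-bound (begin
  L * (4 ^ ℓ * (2 * 2 ^ D))  ≡⟨ pull-2 L (4 ^ ℓ) (2 ^ D) ⟩
  2 * (L * (4 ^ ℓ * 2 ^ D))  ≤⟨ *-mono-≤ (n≤1+n 2) bound ⟩
  3 * (27 ^ ℓ * 3 ^ D)       ≡⟨ pull-3 (27 ^ ℓ) (3 ^ D) ⟩
  27 ^ ℓ * (3 * 3 ^ D)       ∎)
  where
  open ≤-Reasoning
  pull-2 : ∀ L a b → L * (a * (2 * b)) ≡ 2 * (L * (a * b))
  pull-2 = solve-∀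
  pull-3 : ∀ a b → 3 * (a * b) ≡ a * (3 * b)
  pull-3 = solve-∀

countBound-mono : ∀ {L ℓ D D′} → D ≤ D′ → CountBound L ℓ D → CountBound L ℓ D′
countBound-mono D≤D′ = go (≤⇒≤′ D≤D′)
  where
  go : ∀ {L ℓ D D′} → D ≤′ D′ → CountBound L ℓ D → CountBound L ℓ D′
  go ≤′-refl       bound = bound
  go (≤′-step D≤′) bound = countBound-suc (go D≤′ bound)

-- Rejecting a pending pair scales the weight by 2/3; accepting its edge by 4/27 · (3/2)^2 = 1/3.
countBound-step : ∀ {L₁ L₂ ℓ D} → CountBound L₁ ℓ (3 + D) → CountBound L₂ (suc ℓ) D →
                  CountBound (L₁ + L₂) (suc ℓ) (suc D)
countBound-step {L₁} {L₂} {ℓ} {D} (count-bound taken) (count-bound skipped) = count-bound (begin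
  (L₁ + L₂) * (4 ^ suc ℓ * 2 ^ suc D)                                ≡⟨ split L₁ L₂ (4 ^ ℓ) (2 ^ D) ⟩
  L₁ * (4 ^ ℓ * 2 ^ (3 + D)) + 2 * (L₂ * (4 ^ suc ℓ * 2 ^ D))        ≤⟨ +-mono-≤ taken (*-monoʳ-≤ 2 skipped) ⟩
  27 ^ ℓ * 3 ^ (3 + D) + 2 * (27 ^ suc ℓ * 3 ^ D)                    ≡⟨ merge (27 ^ ℓ) (3 ^ D) ⟩
  27 ^ suc ℓ * 3 ^ suc D                                             ∎)
  where
  open ≤-Reasoning
  split : ∀ L₁ L₂ a b → (L₁ + L₂) * (4 * a * (2 * b)) ≡ L₁ * (a * (2 * (2 * (2 * b)))) + 2 * (L₂ * (4 * a * b))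
  split = solve-∀
  merge : ∀ a b → a * (3 * (3 * (3 * b))) + 2 * (27 * a * b) ≡ 27 * a * (3 * b)
  merge = solve-∀

fibre-weight-≤ : ∀ a b → 27 ^ a * 3 ^ (6 * b) ≤ 16 ^ (a + b) * (4 ^ a * 2 ^ (6 * b))
fibre-weight-≤ a b = begin
  27 ^ a * 3 ^ (6 * b)                     ≡⟨ cong (27 ^ a *_) (sym (^-*-assoc 3 6 b)) ⟩
  27 ^ a * 729 ^ b                         ≤⟨ *-mono-≤ (^-monoˡ-≤ a (m≤m+n 27 37)) (^-monoˡ-≤ b (m≤m+n 729 295)) ⟩
  64 ^ a * 1024 ^ b                        ≡⟨ cong₂ _*_ (^-distribʳ-* 16 4 a) (^-distribʳ-* 16 64 b) ⟩
  16 ^ a * 4 ^ a * (16 ^ b * 64 ^ b)       ≡⟨ regroup (16 ^ a) (4 ^ a) (16 ^ b) (64 ^ b) ⟩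
  16 ^ a * 16 ^ b * (4 ^ a * 64 ^ b)       ≡⟨ cong (_* (4 ^ a * 64 ^ b)) (sym (^-distribˡ-+-* 16 a b)) ⟩
  16 ^ (a + b) * (4 ^ a * 64 ^ b)          ≡⟨ cong (λ y → 16 ^ (a + b) * (4 ^ a * y)) (^-*-assoc 2 6 b) ⟩
  16 ^ (a + b) * (4 ^ a * 2 ^ (6 * b))     ∎
  where
  open ≤-Reasoning
  regroup : ∀ w x y z → w * x * (y * z) ≡ w * y * (x * z)
  regroup = solve-∀

module _ {A : Set} {P : A → Set} (P? : Decidable P) where

  length-filter+filter-∁ : ∀ xs → length (filter P? xs) + length (filter (∁? P?) xs) ≡ length xs
  length-filter+filter-∁ []       = refl
  length-filter+filter-∁ (x ∷ xs) with P? x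
  ... | yes _ = cong suc (length-filter+filter-∁ xs)
  ... | no  _ = trans (+-suc _ _) (cong suc (length-filter+filter-∁ xs))

unique-map-on : ∀ {A B : Set} {P : A → Set} (f : A → B) →
                (∀ {x y} → P x → P y → f x ≡ f y → x ≡ y) →
                ∀ {xs} → All P xs → Unique xs → Unique (map f xs)
unique-map-on f inj []         []           = []
unique-map-on f inj (px ∷ pxs) (x∉xs ∷ xs!) =
  All.map⁺ (All.zipWith (λ (x≢y , py) fx≡fy → x≢y (inj px py fx≡fy)) (x∉xs , pxs))
  ∷ unique-map-on f inj pxs xs!

unique-const⇒length≤1 : ∀ {A : Set} {z : A} {xs} → Unique xs → All (_≡ z) xs → length xs ≤ 1
unique-const⇒length≤1 []                  _               = z≤n
unique-const⇒length≤1 (_ ∷ [])            _               = ≤-refl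
unique-const⇒length≤1 ((x≢y ∷ _) ∷ _ ∷ _) (x≡z ∷ y≡z ∷ _) = ⊥-elim (x≢y (trans x≡z (sym y≡z)))

length-concatMap-≤ : ∀ {A B : Set} (f : A → List B) {m} → (∀ x → length (f x) ≤ m) →
                     ∀ xs → length (concatMap f xs) ≤ m * length xs
length-concatMap-≤ f     bound []       = z≤n
length-concatMap-≤ f {m} bound (x ∷ xs) = begin
  length (f x ++ concatMap f xs)          ≡⟨ length-++ (f x) ⟩
  length (f x) + length (concatMap f xs)  ≤⟨ +-mono-≤ (bound x) (length-concatMap-≤ f bound xs) ⟩
  m + m * length xs                       ≡⟨ sym (*-suc m (length xs)) ⟩
  m * suc (length xs)                     ∎
  where open ≤-Reasoning

module _ {A : Set} {P : A → Set} where

  map-proj₁-toList : ∀ {xs} (pxs : All P xs) → map proj₁ (All.toList pxs) ≡ xs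
  map-proj₁-toList []         = refl
  map-proj₁-toList (px ∷ pxs) = cong (_ ∷_) (map-proj₁-toList pxs)

  length-toList : ∀ {xs} (pxs : All P xs) → length (All.toList pxs) ≡ length xs
  length-toList pxs = trans (sym (length-map proj₁ (All.toList pxs))) (cong length (map-proj₁-toList pxs))

  toList-unique : ∀ {xs} → Unique xs → (pxs : All P xs) → AllPairs (_≢_ on proj₁) (All.toList pxs)
  toList-unique xs! pxs = AllPairs.map⁻ (subst Unique (sym (map-proj₁-toList pxs)) xs!)

module _ {A B : Set} {R : A → A → Set} (key : A → B) (_≟_ : DecidableEquality B) (X Y : ℕ)
         (fibre : ∀ b {ys} → AllPairs R ys → All (λ y → key y ≡ b) ys → length ys * X ≤ Y) where

  length-≤-by-fibres : ∀ bs {xs} → AllPairs R xs → All (λ x → key x ∈ₗ bs) xs → length xs * X ≤ length bs * Y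
  length-≤-by-fibres []       {[]}    _   _           = z≤n
  length-≤-by-fibres []       {_ ∷ _} _   (() ∷ _)
  length-≤-by-fibres (b ∷ bs) {xs}    xs! keys∈ = begin
    length xs * X                               ≡⟨ cong (_* X) (sym (length-filter+filter-∁ at-b? xs)) ⟩
    (length at-b + length elsewhere) * X        ≡⟨ *-distribʳ-+ X (length at-b) (length elsewhere) ⟩
    length at-b * X + length elsewhere * X      ≤⟨ +-mono-≤ (fibre b (AllPairs.filter⁺ at-b? xs!) (All.all-filter at-b? xs))
                                                     (length-≤-by-fibres bs (AllPairs.filter⁺ (∁? at-b?) xs!) keys-elsewhere) ⟩
    Y + length bs * Y                           ∎
    where
    open ≤-Reasoning
    at-b? : Decidable (λ x → key x ≡ b)
    at-b? x = key x ≟ b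
    at-b      = filter at-b? xs
    elsewhere = filter (∁? at-b?) xs
    keys-elsewhere : All (λ x → key x ∈ₗ bs) elsewhere
    keys-elsewhere = All.zipWith (λ { (here k≡b , k≢b) → contradiction k≡b k≢b ; (there k∈bs , _) → k∈bs })
                  (All.filter⁺ (∁? at-b?) keys∈ , All.all-filter (∁? at-b?) xs)

x∈p─q⇒x∉q : ∀ {n} {x : Fin n} (p q : Subset n) → x ∈ p ─ q → x ∉ q
x∈p─q⇒x∉q (_ ∷ _) (outside ∷ _) here        ()
x∈p─q⇒x∉q (_ ∷ p) (_       ∷ q) (there x∈) (there x∈q) = x∈p─q⇒x∉q p q x∈ x∈q

x∈p⇒⁅x⁆⊆p : ∀ {n} {x : Fin n} {p} → x ∈ p → ⁅ x ⁆ ⊆ p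
x∈p⇒⁅x⁆⊆p x∈p y∈⁅x⁆ = subst (_∈ _) (sym (x∈⁅y⁆⇒x≡y _ y∈⁅x⁆)) x∈p

─-cancelʳ : ∀ {n} {p p′ q : Subset n} → q ⊆ p → q ⊆ p′ → p ─ q ≡ p′ ─ q → p ≡ p′
─-cancelʳ {q = q} q⊆p q⊆p′ eq = ⊆-antisym (included q⊆p′ eq) (included q⊆p (sym eq))
  where
  included : ∀ {r r′} → q ⊆ r′ → r ─ q ≡ r′ ─ q → r ⊆ r′
  included {r} {r′} q⊆r′ eq {x} x∈r with x ∈? q
  ... | yes x∈q = q⊆r′ x∈q
  ... | no  x∉q = p─q⊆p r′ q (subst (x ∈_) eq (x∈p∧x∉q⇒x∈p─q x∈r x∉q))

∣p∣≡∣p─q∣+∣q∣ : ∀ {n} (p q : Subset n) → q ⊆ p → ∣ p ∣ ≡ ∣ p ─ q ∣ + ∣ q ∣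
∣p∣≡∣p─q∣+∣q∣ []            []            _   = refl
∣p∣≡∣p─q∣+∣q∣ (inside  ∷ p) (outside ∷ q) q⊆p = cong suc (∣p∣≡∣p─q∣+∣q∣ p q (drop-∷-⊆ q⊆p))
∣p∣≡∣p─q∣+∣q∣ (outside ∷ p) (outside ∷ q) q⊆p = ∣p∣≡∣p─q∣+∣q∣ p q (drop-∷-⊆ q⊆p)
∣p∣≡∣p─q∣+∣q∣ (inside  ∷ p) (inside  ∷ q) q⊆p =
  trans (cong suc (∣p∣≡∣p─q∣+∣q∣ p q (drop-∷-⊆ q⊆p))) (sym (+-suc _ _))
∣p∣≡∣p─q∣+∣q∣ (outside ∷ p) (inside  ∷ q) q⊆p = contradiction (q⊆p here) λ ()

∣p∣≡1+∣p-x∣ : ∀ {n} {x : Fin n} {p} → x ∈ p → ∣ p ∣ ≡ suc ∣ p - x ∣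
∣p∣≡1+∣p-x∣ {x = x} {p} x∈p = begin
  ∣ p ∣                  ≡⟨ ∣p∣≡∣p─q∣+∣q∣ p ⁅ x ⁆ (x∈p⇒⁅x⁆⊆p x∈p) ⟩
  ∣ p - x ∣ + ∣ ⁅ x ⁆ ∣  ≡⟨ cong (∣ p - x ∣ +_) (∣⁅x⁆∣≡1 x) ⟩
  ∣ p - x ∣ + 1          ≡⟨ +-comm ∣ p - x ∣ 1 ⟩
  suc ∣ p - x ∣          ∎
  where open ≡-Reasoning

∣⁅x⁆∪p∣≡1+∣p∣ : ∀ {n} (x : Fin n) (p : Subset n) → x ∉ p → ∣ ⁅ x ⁆ ∪ p ∣ ≡ suc ∣ p ∣
∣⁅x⁆∪p∣≡1+∣p∣ zero    (inside  ∷ p) x∉p = contradiction here x∉p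
∣⁅x⁆∪p∣≡1+∣p∣ zero    (outside ∷ p) _   = cong (suc ∘ ∣_∣) (∪-identityˡ p)
∣⁅x⁆∪p∣≡1+∣p∣ (suc x) (inside  ∷ p) x∉p = cong suc (∣⁅x⁆∪p∣≡1+∣p∣ x p (x∉p ∘ there))
∣⁅x⁆∪p∣≡1+∣p∣ (suc x) (outside ∷ p) x∉p = ∣⁅x⁆∪p∣≡1+∣p∣ x p (x∉p ∘ there)

image : ∀ {c n} → (Fin c → Fin n) → Subset n
image {zero}  g = ∅
image {suc c} g = ⁅ g zero ⁆ ∪ image (g ∘ suc)

∈-image : ∀ {c n} (g : Fin c → Fin n) i → g i ∈ image g
∈-image g zero    = x∈p∪q⁺ (inj₁ (x∈⁅x⁆ (g zero)))
∈-image g (suc i) = x∈p∪q⁺ (inj₂ (∈-image (g ∘ suc) i))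

∈-image⁻ : ∀ {c n} (g : Fin c → Fin n) {k} → k ∈ image g → ∃ λ i → g i ≡ k
∈-image⁻ {zero}  g k∈ = contradiction k∈ ∉⊥
∈-image⁻ {suc c} g k∈ with x∈p∪q⁻ ⁅ g zero ⁆ (image (g ∘ suc)) k∈
... | inj₁ k∈⁅g0⁆ = zero , sym (x∈⁅y⁆⇒x≡y _ k∈⁅g0⁆)
... | inj₂ k∈rest = let i , gi≡k = ∈-image⁻ (g ∘ suc) k∈rest in suc i , gi≡k

∣image∣ : ∀ {c n} (g : Fin c → Fin n) → Injective _≡_ _≡_ g → ∣ image g ∣ ≡ c
∣image∣ {zero}  {n} g _   = ∣⊥∣≡0 n
∣image∣ {suc c}     g inj =
  trans (∣⁅x⁆∪p∣≡1+∣p∣ (g zero) _ g0∉) (cong suc (∣image∣ (g ∘ suc) (fsuc-injective ∘ inj)))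
  where
  g0∉ : g zero ∉ image (g ∘ suc)
  g0∉ g0∈ = let i , eq = ∈-image⁻ (g ∘ suc) g0∈ in 0≢1+n (inj (sym eq))

members : ∀ {n} → Subset n → List (Fin n)
members []            = []
members (inside  ∷ p) = zero ∷ map suc (members p)
members (outside ∷ p) = map suc (members p)

length-members : ∀ {n} (p : Subset n) → length (members p) ≡ ∣ p ∣
length-members []            = refl
length-members (inside  ∷ p) = cong suc (trans (length-map suc (members p)) (length-members p))
length-members (outside ∷ p) = trans (length-map suc (members p)) (length-members p)

∈-members⁺ : ∀ {n} {p : Subset n} {x} → x ∈ p → x ∈ₗ members p
∈-members⁺ {p = inside  ∷ p} here        = here refl
∈-members⁺ {p = inside  ∷ p} (there x∈p) = there (∈-map⁺ suc (∈-members⁺ x∈p))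
∈-members⁺ {p = outside ∷ p} (there x∈p) = ∈-map⁺ suc (∈-members⁺ x∈p)

∈-members⁻ : ∀ {n} (p : Subset n) {x} → x ∈ₗ members p → x ∈ p
∈-members⁻ (inside  ∷ p) (here refl) = here
∈-members⁻ (inside  ∷ p) (there x∈)  with ∈-map⁻ suc x∈
... | y , y∈ , refl = there (∈-members⁻ p y∈)
∈-members⁻ (outside ∷ p) x∈          with ∈-map⁻ suc x∈
... | y , y∈ , refl = there (∈-members⁻ p y∈)

ofSize : (m c : ℕ) → List (Subset m)
ofSize zero    zero    = [] ∷ []
ofSize zero    (suc c) = []
ofSize (suc m) zero    = map (outside ∷_) (ofSize m zero)
ofSize (suc m) (suc c) = map (outside ∷_) (ofSize m (suc c)) ++ map (inside ∷_) (ofSize m c)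

length-ofSize : ∀ m c → length (ofSize m c) ≡ m C c
length-ofSize zero    zero    = refl
length-ofSize zero    (suc c) = refl
length-ofSize (suc m) zero    = trans (length-map _ (ofSize m zero)) (length-ofSize m zero)
length-ofSize (suc m) (suc c) = begin
  length (map (outside ∷_) (ofSize m (suc c)) ++ map (inside ∷_) (ofSize m c))
    ≡⟨ length-++ (map (outside ∷_) (ofSize m (suc c))) ⟩
  length (map (outside ∷_) (ofSize m (suc c))) + length (map (inside ∷_) (ofSize m c))
    ≡⟨ cong₂ _+_ (trans (length-map _ (ofSize m (suc c))) (length-ofSize m (suc c)))
                 (trans (length-map _ (ofSize m c)) (length-ofSize m c)) ⟩
  m C suc c + m C c
    ≡⟨ +-comm (m C suc c) (m C c) ⟩
  m C c + m C suc c
    ≡⟨ nCk+nC[k+1]≡[n+1]C[k+1] m c ⟩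
  suc m C suc c ∎
  where open ≡-Reasoning

∈-ofSize : ∀ {m c} (p : Subset m) → ∣ p ∣ ≡ c → p ∈ₗ ofSize m c
∈-ofSize {c = zero}  []            _    = here refl
∈-ofSize {c = zero}  (outside ∷ p) ∣p∣≡ = ∈-map⁺ (outside ∷_) (∈-ofSize p ∣p∣≡)
∈-ofSize {c = suc c} (outside ∷ p) ∣p∣≡ = ∈-++⁺ˡ (∈-map⁺ (outside ∷_) (∈-ofSize p ∣p∣≡))
∈-ofSize {c = suc c} (inside  ∷ p) ∣p∣≡ =
  ∈-++⁺ʳ (map (outside ∷_) (ofSize _ (suc c))) (∈-map⁺ (inside ∷_) (∈-ofSize p (suc-injective ∣p∣≡)))

-- The square of the cycle

smallOffsets : List ℕ
smallOffsets = 1 ∷ 2 ∷ []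

offsets : ℕ → List ℕ
offsets n = smallOffsets ++ map (n ∸_) smallOffsets

∈-smallOffsets : ∀ {d} → 1 ≤ d → d ≤ 2 → d ∈ₗ smallOffsets
∈-smallOffsets (s≤s z≤n) (s≤s z≤n)       = here refl
∈-smallOffsets (s≤s z≤n) (s≤s (s≤s z≤n)) = there (here refl)

∈-smallOffsets⇒≤2 : ∀ {d} → d ∈ₗ smallOffsets → d ≤ 2
∈-smallOffsets⇒≤2 (here refl)         = n≤1+n 1
∈-smallOffsets⇒≤2 (there (here refl)) = ≤-refl

offsets-reflect : ∀ {n d} → 2 ≤ n → d ∈ₗ offsets n → n ∸ d ∈ₗ offsets n
offsets-reflect {n} 2≤n d∈ with ∈-++⁻ smallOffsets d∈
... | inj₁ d∈small = ∈-++⁺ʳ smallOffsets (∈-map⁺ (n ∸_) d∈small)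
... | inj₂ d∈far   with ∈-map⁻ (n ∸_) {xs = smallOffsets} d∈far
...   | e , e∈small , refl =
  ∈-++⁺ˡ (subst (_∈ₗ smallOffsets) (sym (m∸[m∸n]≡n (≤-trans (∈-smallOffsets⇒≤2 e∈small) 2≤n))) e∈small)

sqEdge-offset : ∀ {n i j} → IsSqEdge n (i , j) → toℕ j ∸ toℕ i ∈ₗ offsets n
sqEdge-offset (i<j , inj₁ d≤2) = ∈-++⁺ˡ (∈-smallOffsets (m<n⇒0<n∸m i<j) d≤2)
sqEdge-offset {n} {i} {j} (i<j , inj₂ n≤d+2) =
  ∈-++⁺ʳ smallOffsets (subst (_∈ₗ map (n ∸_) smallOffsets) (m∸[m∸n]≡n (<⇒≤ d<n))
                         (∈-map⁺ (n ∸_) (∈-smallOffsets (m<n⇒0<n∸m d<n) n∸d≤2)))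
  where
  d = toℕ j ∸ toℕ i
  d<n : d < n
  d<n = ≤-<-trans (m∸n≤m (toℕ j) (toℕ i)) (toℕ<n j)
  n∸d≤2 : n ∸ d ≤ 2
  n∸d≤2 = ≤-trans (∸-monoˡ-≤ d n≤d+2) (≤-reflexive (m+n∸m≡n d 2))

module _ {n : ℕ} {{_ : NonZero n}} where

  _⊕_ : Fin n → ℕ → Fin n
  v ⊕ d = (toℕ v + d) mod n

  neighbours : Fin n → List (Fin n)
  neighbours v = map (v ⊕_) (offsets n)

  %-toℕ : ∀ {m} (v : Fin n) → m % n ≡ toℕ v → m mod n ≡ v
  %-toℕ v eq = toℕ-injective (trans (toℕ-fromℕ< _) eq)

  ⊕-forward : ∀ {i j : Fin n} → toℕ i ≤ toℕ j → i ⊕ (toℕ j ∸ toℕ i) ≡ j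
  ⊕-forward {i} {j} i≤j = %-toℕ j (trans (cong (_% n) (m+[n∸m]≡n i≤j)) (m<n⇒m%n≡m (toℕ<n j)))

  ⊕-backward : ∀ {i j : Fin n} → toℕ i ≤ toℕ j → j ⊕ (n ∸ (toℕ j ∸ toℕ i)) ≡ i
  ⊕-backward {i} {j} i≤j =
    %-toℕ i (trans (cong (_% n) wraps) (trans ([m+n]%n≡m%n (toℕ i) n) (m<n⇒m%n≡m (toℕ<n i))))
    where
    open ≡-Reasoning
    d = toℕ j ∸ toℕ i
    wraps : toℕ j + (n ∸ d) ≡ toℕ i + n
    wraps = begin
      toℕ j + (n ∸ d)       ≡⟨ cong (_+ (n ∸ d)) (sym (m+[n∸m]≡n i≤j)) ⟩
      toℕ i + d + (n ∸ d)   ≡⟨ +-assoc (toℕ i) d (n ∸ d) ⟩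
      toℕ i + (d + (n ∸ d)) ≡⟨ cong (toℕ i +_) (m+[n∸m]≡n (≤-trans (m∸n≤m (toℕ j) (toℕ i)) (<⇒≤ (toℕ<n j)))) ⟩
      toℕ i + n             ∎

  sqEdge⇒∈neighbours : ∀ {i j} → 2 ≤ n → IsSqEdge n (i , j) → j ∈ₗ neighbours i × i ∈ₗ neighbours j
  sqEdge⇒∈neighbours {i} {j} 2≤n e@(i<j , _) =
    subst (_∈ₗ neighbours i) (⊕-forward (<⇒≤ i<j)) (∈-map⁺ (i ⊕_) (sqEdge-offset e)) ,
    subst (_∈ₗ neighbours j) (⊕-backward (<⇒≤ i<j)) (∈-map⁺ (j ⊕_) (offsets-reflect 2≤n (sqEdge-offset e)))

  _≢?_ : ∀ (y w : Fin n) → Dec (y ≢ w)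
  y ≢? w = ¬? (y ≟ᶠ w)

  -- The pending pairs of a vertex v entered through the edge vw.
  around : Fin n → Fin n → List (Fin n × Fin n)
  around v w = map (v ,_) (filter (_≢? w) (neighbours v))

  length-around : ∀ {v w} → w ∈ₗ neighbours v → length (around v w) ≤ 3
  length-around {v} {w} w∈ = begin
    length (around v w)                     ≡⟨ length-map (v ,_) (filter (_≢? w) (neighbours v)) ⟩
    length (filter (_≢? w) (neighbours v))  ≤⟨ s≤s⁻¹ (filter-notAll (_≢? w) (neighbours v) w-dropped) ⟩
    3                                       ∎
    where
    open ≤-Reasoning
    w-dropped : Any.Any (λ y → ¬ y ≢ w) (neighbours v)
    w-dropped = Any.map (λ w≡y y≢w → y≢w (sym w≡y)) w∈

  ∈-around : ∀ {v w z} → z ∈ₗ neighbours v → z ≢ w → (v , z) ∈ₗ around v w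
  ∈-around {v} {w} z∈ z≢w = ∈-map⁺ (v ,_) (∈-filter⁺ (_≢? w) z∈ z≢w)

  around-root : ∀ {v w q y} → (q , y) ∈ₗ around v w → q ≡ v
  around-root p∈ with ∈-map⁻ _ p∈
  ... | _ , _ , refl = refl

-- Edge sets of the square of the cycle

module _ {n h : ℕ} {{_ : NonZero n}} (2≤n : 2 ≤ n) {F : Vec (Fin n × Fin n) h}
         (sq : VAll (IsSqEdge n) F) (F-injective : Injective _≡_ _≡_ (lookup F)) where

  src tgt : Fin h → Fin n
  src k = proj₁ (lookup F k)
  tgt k = proj₂ (lookup F k)

  Joins : Fin h → Fin n → Fin n → Set
  Joins k u w = lookup F k ≡ (u , w) ⊎ lookup F k ≡ (w , u)

  joins-sym : ∀ {k u w} → Joins k u w → Joins k w u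
  joins-sym = ⊎-swap

  joins? : ∀ k u w → Dec (Joins k u w)
  joins? k u w = ×-≡-dec _≟ᶠ_ _≟ᶠ_ (lookup F k) (u , w) ⊎-dec ×-≡-dec _≟ᶠ_ _≟ᶠ_ (lookup F k) (w , u)

  joins-sqEdge : ∀ {k u w} → lookup F k ≡ (u , w) → IsSqEdge n (u , w)
  joins-sqEdge {k} e = subst (IsSqEdge n) e (lookup⁺ sq k)

  joins-unique : ∀ {k k′ u w} → Joins k u w → Joins k′ u w → k ≡ k′
  joins-unique (inj₁ e) (inj₁ e′) = F-injective (trans e (sym e′))
  joins-unique (inj₂ e) (inj₂ e′) = F-injective (trans e (sym e′))
  joins-unique (inj₁ e) (inj₂ e′) = ⊥-elim (<-asym (proj₁ (joins-sqEdge e)) (proj₁ (joins-sqEdge e′)))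
  joins-unique (inj₂ e) (inj₁ e′) = ⊥-elim (<-asym (proj₁ (joins-sqEdge e)) (proj₁ (joins-sqEdge e′)))

  joins⇒∈neighbours : ∀ {k u w} → Joins k u w → w ∈ₗ neighbours u
  joins⇒∈neighbours (inj₁ e) = proj₁ (sqEdge⇒∈neighbours 2≤n (joins-sqEdge e))
  joins⇒∈neighbours (inj₂ e) = proj₂ (sqEdge⇒∈neighbours 2≤n (joins-sqEdge e))

  joins-endpoint : ∀ {k u w r x} → Joins k u w → Joins k r x → u ≡ r ⊎ u ≡ x
  joins-endpoint (inj₁ e) (inj₁ e′) = inj₁ (cong proj₁ (trans (sym e) e′))
  joins-endpoint (inj₁ e) (inj₂ e′) = inj₂ (cong proj₁ (trans (sym e) e′))
  joins-endpoint (inj₂ e) (inj₁ e′) = inj₂ (cong proj₂ (trans (sym e) e′))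
  joins-endpoint (inj₂ e) (inj₂ e′) = inj₁ (cong proj₂ (trans (sym e) e′))

  adj⇒joins : ∀ {J u w} → AdjJ F J u w → ∃ λ k → k ∈ J × Joins k u w
  adj⇒joins (inj₁ (k , k∈J , e)) = k , k∈J , inj₁ e
  adj⇒joins (inj₂ (k , k∈J , e)) = k , k∈J , inj₂ e

  joins⇒adj : ∀ {J k u w} → k ∈ J → Joins k u w → AdjJ F J u w
  joins⇒adj k∈J (inj₁ e) = inj₁ (_ , k∈J , e)
  joins⇒adj k∈J (inj₂ e) = inj₂ (_ , k∈J , e)

  joins⇒incident : ∀ {J k u w} → k ∈ J → Joins k u w → Incident F J u
  joins⇒incident k∈J j = _ , joins⇒adj k∈J j

  incident-mono : ∀ {J J′} → J′ ⊆ J → ∀ {v} → Incident F J′ v → Incident F J v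
  incident-mono J′⊆J (w , a) = let k , k∈J′ , j = adj⇒joins a in w , joins⇒adj (J′⊆J k∈J′) j

  connected⇒incident : ∀ {J v q} → Incident F J v → Connected F J v q → Incident F J q
  connected⇒incident v∈ ε          = v∈
  connected⇒incident v∈ (a ◅ path) = connected⇒incident (_ , ⊎-swap a) path

  -- Follow the path until its first edge in R.
  connected-until : ∀ {J R : Subset h} {P : Fin n → Set} → (∀ {k u w} → k ∈ R → Joins k u w → P u) →
                    ∀ {v q} → Connected F J v q → P q → ∃ λ q′ → P q′ × Connected F (J ─ R) v q′
  connected-until ends ε          Pq = _ , Pq , ε
  connected-until {R = R} ends (a ◅ path) Pq with adj⇒joins a
  ... | k , k∈J , j with k ∈? R
  ...   | yes k∈R = _ , ends k∈R j , ε
  ...   | no  k∉R = let q′ , Pq′ , path′ = connected-until ends path Pq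
                    in q′ , Pq′ , joins⇒adj (x∈p∧x∉q⇒x∈p─q k∈J k∉R) j ◅ path′

  Covered : List (Fin n × Fin n) → Subset h → Fin n → Set
  Covered ps J q = ∀ {k z} → k ∈ J → Joins k q z → (q , z) ∈ₗ ps

  NoEdge : Subset h → Fin n → Fin n → Set
  NoEdge J r x = ∀ {k} → k ∈ J → ¬ Joins k r x

  covered-drop : ∀ {J J′ r x ps q} → J′ ⊆ J → NoEdge J′ r x → Covered ((r , x) ∷ ps) J q → Covered ps J′ q
  covered-drop J′⊆J none cov k∈J′ j with cov (J′⊆J k∈J′) j
  ... | here refl = ⊥-elim (none k∈J′ j)
  ... | there p∈  = p∈

  covered-around : ∀ {J v w} → NoEdge J v w → Covered (around v w) J v
  covered-around none k∈J j = ∈-around (joins⇒∈neighbours j) λ { refl → none k∈J j }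

  no-edge-after-removal : ∀ {J R k u w} → k ∈ R → Joins k u w → NoEdge (J ─ R) u w
  no-edge-after-removal {J} {R} k∈R j k′∈ j′ = x∈p─q⇒x∉q J R k′∈ (subst (_∈ R) (joins-unique j j′) k∈R)

  no-edge-without : ∀ {J k u w} → k ∉ J → Joins k u w → NoEdge J u w
  no-edge-without k∉J j k′∈J j′ = k∉J (subst (_∈ _) (joins-unique j′ j) k′∈J)

  covered-[]⇒isolated : ∀ {J q} → Covered [] J q → ¬ Incident F J q
  covered-[]⇒isolated cov (_ , a) with adj⇒joins a
  ... | _ , k∈J , j with () ← cov k∈J j

  -- A state of the exploration of J: ps holds the undecided (vertex , neighbour) pairs, and every
  -- vertex of J is connected to one all of whose edges in J are still undecided.
  record RootedBy (ps : List (Fin n × Fin n)) (ℓ : ℕ) (J : Subset h) : Set where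
    field
      size    : ∣ J ∣ ≡ ℓ
      closed  : ∀ {q y} → (q , y) ∈ₗ ps → Covered ps J q
      reaches : ∀ {v} → Incident F J v → ∃ λ q → Covered ps J q × Connected F J v q

  open RootedBy

  rooted-0⇒∅ : ∀ {ps J} → RootedBy ps 0 J → J ≡ ∅
  rooted-0⇒∅ ρ = Empty-unique λ (k , k∈J) → m<n⇒n≢0 (x∈p⇒∣p-x∣<∣p∣ k∈J) (size ρ)

  rooted-[]⇒∅ : ∀ {ℓ J} → RootedBy [] ℓ J → J ≡ ∅
  rooted-[]⇒∅ ρ = Empty-unique λ (k , k∈J) →
    let src∈ = joins⇒incident k∈J (inj₁ refl)
        q , cov , path = reaches ρ src∈
    in covered-[]⇒isolated cov (connected⇒incident src∈ path)

  rooted-drop : ∀ {r x ps ℓ J} → NoEdge J r x → RootedBy ((r , x) ∷ ps) ℓ J → RootedBy ps ℓ J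
  rooted-drop none ρ = record
    { size    = size ρ
    ; closed  = λ p∈ → covered-drop ⊆-refl none (closed ρ (there p∈))
    ; reaches = λ v∈ → let q , cov , path = reaches ρ v∈ in q , covered-drop ⊆-refl none cov , path
    }

  rooted-take : ∀ {k r x ps ℓ J} → k ∈ J → Joins k r x →
                RootedBy ((r , x) ∷ ps) (suc ℓ) J → RootedBy (around x r ++ ps) ℓ (J - k)
  rooted-take {k} {r} {x} {ps} {ℓ} {J} k∈J j ρ = record
    { size    = suc-injective (trans (sym (∣p∣≡1+∣p-x∣ k∈J)) (size ρ))
    ; closed  = closed′
    ; reaches = λ v∈ → let q , cov , path = reaches ρ (incident-mono (p─q⊆p J ⁅ k ⁆) v∈)
                       in connected-until at-endpoint path (shrink cov)
    }
    where
    ps′ = around x r ++ ps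
    none : NoEdge (J - k) r x
    none = no-edge-after-removal (x∈⁅x⁆ k) j
    shrink : ∀ {q} → Covered ((r , x) ∷ ps) J q → Covered ps′ (J - k) q
    shrink cov k′∈ j′ = ∈-++⁺ʳ (around x r) (covered-drop (p─q⊆p J ⁅ k ⁆) none cov k′∈ j′)
    at-x : Covered ps′ (J - k) x
    at-x k′∈ j′ = ∈-++⁺ˡ (covered-around (λ k″∈ → none k″∈ ∘ joins-sym) k′∈ j′)
    at-endpoint : ∀ {k′ u w} → k′ ∈ ⁅ k ⁆ → Joins k′ u w → Covered ps′ (J - k) u
    at-endpoint k′∈ j′ with joins-endpoint (subst (λ k″ → Joins k″ _ _) (x∈⁅y⁆⇒x≡y k k′∈) j′) j
    ... | inj₁ refl = shrink (closed ρ (here refl))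
    ... | inj₂ refl = at-x
    closed′ : ∀ {q y} → (q , y) ∈ₗ ps′ → Covered ps′ (J - k) q
    closed′ p∈ with ∈-++⁻ (around x r) p∈
    ... | inj₁ p∈around with refl ← around-root p∈around = at-x
    ... | inj₂ p∈ps = shrink (closed ρ (there p∈ps))

  RootedCount : List (Fin n × Fin n) → ℕ → Set
  RootedCount ps ℓ = ∀ {Js} → Unique Js → All (RootedBy ps ℓ) Js → CountBound (length Js) ℓ (length ps)

  -- Deciding the pending pair (r , x): J either avoids the edge rx, or contains it and x becomes a root.
  count-step : ∀ {ℓ r x ps} → RootedCount (around x r ++ ps) ℓ → RootedCount ps (suc ℓ) →
               RootedCount ((r , x) ∷ ps) (suc ℓ)
  count-step {ℓ} {r} {x} {ps} count-taken count-skipped {Js} Js! ρs with any? (λ k → joins? k r x)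
  ... | no ∄k = countBound-suc (count-skipped Js! (All.map (rooted-drop λ {k} _ j → ∄k (k , j)) ρs))
  ... | yes (k , j) =
    subst (λ L → CountBound L (suc ℓ) (suc (length ps))) (length-filter+filter-∁ (k ∈?_) Js)
      (countBound-step taken skipped)
    where
    with-k    = filter (k ∈?_) Js
    without-k = filter (∁? (k ∈?_)) Js

    length-taken-ps : length (around x r ++ ps) ≤ 3 + length ps
    length-taken-ps = subst (_≤ 3 + length ps) (sym (length-++ (around x r)))
                        (+-monoˡ-≤ (length ps) (length-around (joins⇒∈neighbours (joins-sym j))))

    trimmed! : Unique (map (_- k) with-k)
    trimmed! = unique-map-on (_- k) (λ k∈J k∈J′ → ─-cancelʳ (x∈p⇒⁅x⁆⊆p k∈J) (x∈p⇒⁅x⁆⊆p k∈J′))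
                 (All.all-filter (k ∈?_) Js) (Unique.filter⁺ (k ∈?_) Js!)

    trimmed-rooted : All (RootedBy (around x r ++ ps) ℓ) (map (_- k) with-k)
    trimmed-rooted = All.map⁺ (All.zipWith (λ (k∈J , ρ) → rooted-take k∈J j ρ)
                                 (All.all-filter (k ∈?_) Js , All.filter⁺ (k ∈?_) ρs))

    taken : CountBound (length with-k) ℓ (3 + length ps)
    taken = subst (λ L → CountBound L ℓ (3 + length ps)) (length-map (_- k) with-k)
              (countBound-mono length-taken-ps (count-taken trimmed! trimmed-rooted))

    skipped : CountBound (length without-k) (suc ℓ) (length ps)
    skipped = count-skipped (Unique.filter⁺ (∁? (k ∈?_)) Js!)
                (All.zipWith (λ (k∉J , ρ) → rooted-drop (no-edge-without k∉J j) ρ)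
                  (All.all-filter (∁? (k ∈?_)) Js , All.filter⁺ (∁? (k ∈?_)) ρs))

  rooted-count : ∀ ℓ ps → RootedCount ps ℓ
  rooted-count zero    ps Js! ρs =
    countBound-≤1 0 (length ps) (unique-const⇒length≤1 Js! (All.map rooted-0⇒∅ ρs))
  rooted-count (suc ℓ) [] Js! ρs =
    countBound-≤1 (suc ℓ) 0 (unique-const⇒length≤1 Js! (All.map rooted-[]⇒∅ ρs))
  rooted-count (suc ℓ) ((r , x) ∷ ps) =
    count-step (rooted-count ℓ (around x r ++ ps)) (rooted-count (suc ℓ) ps)

  pairSeeds : Fin n × Fin n → List (Fin n × Fin n)
  pairSeeds e = around (proj₁ e) (proj₂ e) ++ around (proj₂ e) (proj₁ e)

  seeds : Subset h → List (Fin n × Fin n)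
  seeds R = concatMap (pairSeeds ∘ lookup F) (members R)

  length-seeds : ∀ R → length (seeds R) ≤ 6 * ∣ R ∣
  length-seeds R = subst (λ m → length (seeds R) ≤ 6 * m) (length-members R)
                     (length-concatMap-≤ (pairSeeds ∘ lookup F) length-pairSeeds (members R))
    where
    length-pairSeeds : ∀ k → length (pairSeeds (lookup F k)) ≤ 6
    length-pairSeeds k = subst (_≤ 6) (sym (length-++ (around (src k) (tgt k))))
      (+-mono-≤ (length-around (joins⇒∈neighbours (inj₁ refl))) (length-around (joins⇒∈neighbours (inj₂ refl))))

  ∈-seeds : ∀ {R k u w p} → k ∈ R → Joins k u w → p ∈ₗ around u w → p ∈ₗ seeds R
  ∈-seeds {R} k∈R j p∈ = concatMap⁺ (pairSeeds ∘ lookup F) (Any.map (λ { refl → in-pair j }) (∈-members⁺ k∈R))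
    where
    in-pair : ∀ {k} → Joins k _ _ → _ ∈ₗ pairSeeds (lookup F k)
    in-pair (inj₁ e) = subst (λ e → _ ∈ₗ pairSeeds e) (sym e) (∈-++⁺ˡ p∈)
    in-pair (inj₂ e) = subst (λ e → _ ∈ₗ pairSeeds e) (sym e) (∈-++⁺ʳ (around _ _) p∈)

  seeds-root : ∀ {R q y} → (q , y) ∈ₗ seeds R → ∃₂ λ k w → k ∈ R × Joins k q w
  seeds-root {R} p∈ with find (concatMap⁻ (pairSeeds ∘ lookup F) {xs = members R} p∈)
  ... | k , k∈ , p∈k with ∈-++⁻ (around (src k) (tgt k)) p∈k
  ...   | inj₁ p∈src with refl ← around-root p∈src = k , tgt k , ∈-members⁻ R k∈ , inj₁ refl
  ...   | inj₂ p∈tgt with refl ← around-root p∈tgt = k , src k , ∈-members⁻ R k∈ , inj₂ refl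

  seeds-cover : ∀ {J R k u w} → k ∈ R → Joins k u w → Covered (seeds R) (J ─ R) u
  seeds-cover k∈R j k′∈ j′ = ∈-seeds k∈R j (covered-around (no-edge-after-removal k∈R j) k′∈ j′)

  rooted-remainder : ∀ {J R ℓ c} → R ⊆ J → ∣ J ∣ ≡ ℓ → ∣ R ∣ ≡ c →
                     (∀ {v} → Incident F J v → ∃ λ k → k ∈ R × Connected F J v (src k)) →
                     RootedBy (seeds R) (ℓ ∸ c) (J ─ R)
  rooted-remainder {J} {R} R⊆J refl refl spans = record
    { size    = sym (trans (cong (_∸ ∣ R ∣) (∣p∣≡∣p─q∣+∣q∣ J R R⊆J)) (m+n∸n≡m ∣ J ─ R ∣ ∣ R ∣))
    ; closed  = λ p∈ → let k , w , k∈R , j = seeds-root p∈ in seeds-cover k∈R j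
    ; reaches = λ v∈ → let k , k∈R , path = spans (incident-mono (p─q⊆p J R) v∈)
                       in connected-until (seeds-cover {J}) path (seeds-cover {J} k∈R (inj₁ refl))
    }

  SplitsAt : ℕ → ℕ → Subset h → Subset h → Set
  SplitsAt ℓ c R J = ∣ R ∣ ≡ c × R ⊆ J × RootedBy (seeds R) (ℓ ∸ c) (J ─ R)

  module Representatives {ℓ c J} (good : GoodSubset F ℓ c J) where

    private
      label : Fin n → Fin c
      label = proj₁ (proj₂ good)

      same-label⇔connected : ∀ u v → Incident F J u → Incident F J v → (label u ≡ label v) ⇔ Connected F J u v
      same-label⇔connected = proj₁ (proj₂ (proj₂ good))

    src-connected : ∀ {k v w} → k ∈ J → Joins k v w → Connected F J (src k) v
    src-connected {k} k∈J (inj₁ e) = subst (Connected F J (src k)) (cong proj₁ e) ε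
    src-connected {k} k∈J (inj₂ e) = subst (Connected F J (src k)) (cong proj₂ e) (joins⇒adj k∈J (inj₁ refl) ◅ ε)

    component-edge : ∀ i → ∃ λ k → k ∈ J × label (src k) ≡ i
    component-edge i with proj₂ (proj₂ (proj₂ good)) i
    ... | v , v∈ , refl with adj⇒joins (proj₂ v∈)
    ...   | k , k∈J , j = k , k∈J , Equivalence.from (same-label⇔connected _ v src∈ v∈) (src-connected k∈J j)
      where src∈ = joins⇒incident k∈J (inj₁ refl)

    rep : Fin c → Fin h
    rep i = proj₁ (component-edge i)

    rep∈J : ∀ i → rep i ∈ J
    rep∈J i = proj₁ (proj₂ (component-edge i))

    label-rep : ∀ i → label (src (rep i)) ≡ i
    label-rep i = proj₂ (proj₂ (component-edge i))

    reps : Subset h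
    reps = image rep

    reps⊆J : reps ⊆ J
    reps⊆J k∈ with ∈-image⁻ rep k∈
    ... | i , refl = rep∈J i

    ∣reps∣ : ∣ reps ∣ ≡ c
    ∣reps∣ = ∣image∣ rep λ {i} {i′} eq →
      trans (sym (label-rep i)) (trans (cong (label ∘ src) eq) (label-rep i′))

    spans : ∀ {v} → Incident F J v → ∃ λ k → k ∈ reps × Connected F J v (src k)
    spans {v} v∈ = rep (label v) , ∈-image rep (label v) ,
      Equivalence.to (same-label⇔connected v _ v∈ (joins⇒incident (rep∈J (label v)) (inj₁ refl)))
        (sym (label-rep (label v)))

    splits : SplitsAt ℓ c reps J
    splits = ∣reps∣ , reps⊆J , rooted-remainder reps⊆J (proj₁ good) ∣reps∣ spans

  fibre-count : ∀ {ℓ c R Js} → Unique Js → All (SplitsAt ℓ c R) Js →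
                length Js * (4 ^ (ℓ ∸ c) * 2 ^ (6 * c)) ≤ 27 ^ (ℓ ∸ c) * 3 ^ (6 * c)
  fibre-count {Js = []}     _   _ = z≤n
  fibre-count {ℓ} {c} {R} {Js@(_ ∷ _)} Js! splits@((∣R∣≡c , _ , _) ∷ _) =
    subst (λ L → L * (4 ^ (ℓ ∸ c) * 2 ^ (6 * c)) ≤ 27 ^ (ℓ ∸ c) * 3 ^ (6 * c)) (length-map (_─ R) Js)
      (cleared (countBound-mono length-seeds≤ (rooted-count (ℓ ∸ c) (seeds R) remainders! remainders-rooted)))
    where
    length-seeds≤ : length (seeds R) ≤ 6 * c
    length-seeds≤ = subst (λ m → length (seeds R) ≤ 6 * m) ∣R∣≡c (length-seeds R)
    remainders! : Unique (map (_─ R) Js)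
    remainders! = unique-map-on (_─ R) (λ (_ , R⊆J , _) (_ , R⊆J′ , _) → ─-cancelʳ R⊆J R⊆J′) splits Js!
    remainders-rooted : All (RootedBy (seeds R) (ℓ ∸ c)) (map (_─ R) Js)
    remainders-rooted = All.map⁺ (All.map (proj₂ ∘ proj₂) splits)

  good-count : ∀ {ℓ c Js} → Unique Js → All (GoodSubset F ℓ c) Js → length Js ≤ 16 ^ ℓ * (h C c)
  good-count {Js = []} _ _ = z≤n
  good-count {ℓ} {c} {Js} Js! goods@(good ∷ _) =
    *-cancelʳ-≤ (length Js) (16 ^ ℓ * (h C c)) X {{m*n≢0 _ _ {{m^n≢0 4 (ℓ ∸ c)}} {{m^n≢0 2 (6 * c)}}}} (begin
      length Js * X                      ≡⟨ cong (_* X) (sym (length-toList goods)) ⟩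
      length keyed * X                   ≤⟨ length-≤-by-fibres key (Vec-≡-dec _≟ᵇ_) X Y fibre (ofSize h c)
                                              (toList-unique Js! goods) keys∈ ⟩
      length (ofSize h c) * Y            ≡⟨ cong (_* Y) (length-ofSize h c) ⟩
      (h C c) * Y                        ≤⟨ *-monoʳ-≤ (h C c) (fibre-weight-≤ (ℓ ∸ c) c) ⟩
      (h C c) * (16 ^ (ℓ ∸ c + c) * X)   ≡⟨ cong (λ e → (h C c) * (16 ^ e * X)) (m∸n+n≡m c≤ℓ) ⟩
      (h C c) * (16 ^ ℓ * X)             ≡⟨ swap-front (h C c) (16 ^ ℓ) X ⟩
      16 ^ ℓ * (h C c) * X               ∎)
    where
    open ≤-Reasoning
    X = 4 ^ (ℓ ∸ c) * 2 ^ (6 * c)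
    Y = 27 ^ (ℓ ∸ c) * 3 ^ (6 * c)
    swap-front : ∀ a b x → a * (b * x) ≡ b * a * x
    swap-front = solve-∀

    c≤ℓ : c ≤ ℓ
    c≤ℓ = subst₂ _≤_ (Representatives.∣reps∣ good) (proj₁ good) (p⊆q⇒∣p∣≤∣q∣ (Representatives.reps⊆J good))

    keyed = All.toList goods

    key : ∃ (GoodSubset F ℓ c) → Subset h
    key (_ , good) = Representatives.reps good

    keys∈ : All (λ y → key y ∈ₗ ofSize h c) keyed
    keys∈ = All.universal (λ (_ , good) → ∈-ofSize _ (Representatives.∣reps∣ good)) keyed

    splits-at-key : ∀ {y R} → key y ≡ R → SplitsAt ℓ c R (proj₁ y)
    splits-at-key {_ , good} refl = Representatives.splits good

    fibre : ∀ R {ys} → AllPairs (_≢_ on proj₁) ys → All (λ y → key y ≡ R) ys → length ys * X ≤ Y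
    fibre R {ys} ys! keys≡R = subst (λ L → L * X ≤ Y) (length-map proj₁ ys)
      (fibre-count (AllPairs.map⁺ ys!) (All.map⁺ (All.map (λ {y} → splits-at-key {y}) keys≡R)))

proposition2p2 : (n : ℕ) → 3 ≤ n → (h : ℕ) → (F : Vec (Fin n × Fin n) h)
    → VAll (IsSqEdge n) F → Injective _≡_ _≡_ (lookup F)
    → (ℓ c : ℕ) → (Js : List (Subset h)) → Unique Js → All (GoodSubset F ℓ c) Js
    → BoundedBy8eC (length Js) ℓ h c
proposition2p2 n 3≤n h F sq F-injective ℓ c Js Js! goods =
  16^ℓ-bound⇒BoundedBy8eC {ℓ = ℓ} {h} {c}
    (good-count {{>-nonZero (≤-trans (s≤s z≤n) 3≤n)}} (≤-trans (n≤1+n 2) 3≤n) sq F-injective Js! goods)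
    (C-monoˡ c (m≤n*m h 2))
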